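{- Let $\mathbb{F}$ be an ordered field. Let $\mathcal{N}_1,\mathcal{N}_2$ be two normal systems in $\mathbb{F}^3$ with sets $\mathcal{U}_1,\mathcal{U}_2$ of antipodal pairs of $\mathbb{F}$-vectors, and let $G_1,G_2$ be their graphs of compatible pairs. If $\delta:\mathcal{U}_1\to\mathcal{U}_2$ is a convex positive bijection, then the map $\{x,y\}\mapsto\{\delta(x),\delta(y)\}$ is a graph isomorphism $G_1\to G_2$. Conversely, if $\delta:\mathcal{U}_1\to\mathcal{U}_2$ is a bijection with $\delta(-u)=-\delta(u)$ for all $u$ such that $\{x,y\}\mapsto\{\delta(x),\delta(y)\}$ is a graph isomorphism $G_1\to G_2$, then $\delta$ is a convex positive bijection.
   Context: An ordered field is a totally ordered field with $x\le y\Rightarrow x+z\le y+z$ and $x,y\ge0\Rightarrow xy\ge0$. A normal system in $\mathbb{F}^m$ is a finite set $\{L_1,\ldots,L_n\}$ of lines through the origin such that, choosing nonzero $v_i\in L_i$, every subset of $\{v_1,\ldots,v_n\}$ of size at most $m$ is linearly independent; $\mathcal{U}=\{\pm v_1,\ldots,\pm v_n\}$ is a set of antipodal pairs of $\mathbb{F}$-vectors. A bijection $\delta:\mathcal{U}_1\to\mathcal{U}_2$ is a convex positive bijection if $\delta(-u)=-\delta(u)$ and for every basis $\{u_1,\ldots,u_m\}\subset\mathcal{U}_1$ of $\mathbb{F}^m$ and $u\in\mathcal{U}_1$: $u=\sum a_iu_i$ with all $a_i>0$ iff $\delta(u)=\sum b_i\delta(u_i)$ with all $b_i>0$. The graph of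 compatible pairs $G=(V,E)$ of a normal system in $\mathbb{F}^3$ with set $\mathcal{U}$ has vertex set $V=\{\{x,y\}: x,y\in\mathcal{U}, x\ne\pm y\}$, and two distinct vertices $\{x_1,y_1\},\{x_2,y_2\}$ are joined by an edge iff there exist $a,b,c,d>0$ in $\mathbb{F}$ with $ax_1+by_1=cx_2+dy_2$. -}

module Defs where

open import Level using (Level; _⊔_)
open import Data.Nat using (ℕ; zero)
import Data.Nat as ℕ
open import Data.Fin using (Fin; zero; suc)
open import Data.Bool using (Bool; true; false; not)
open import Data.Product using (Σ; ∃; _×_; _,_; proj₁; proj₂)
open import Data.Sum using (_⊎_)
open import Relation.Nullary using (¬_)
open import Relation.Binary.PropositionalEquality using (_≡_; _≢_)
open import Relation.Binary.Structures using (IsTotalOrder)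
open import Algebra.Structures using (IsCommutativeRing)
open import Function.Base using (_∘_)
open import Function.Bundles using (_⇔_)
open import Function.Definitions using (Injective; Bijective)

record OrderedField (c ℓ₁ ℓ₂ : Level) : Set (Level.suc (c ⊔ ℓ₁ ⊔ ℓ₂)) where
  infix  4 _≈_ _≤_
  infixl 6 _+_
  infixl 7 _*_
  field
    Carrier : Set c
    _≈_     : Carrier → Carrier → Set ℓ₁
    _+_     : Carrier → Carrier → Carrier
    _*_     : Carrier → Carrier → Carrier
    -_      : Carrier → Carrier
    0#      : Carrier
    1#      : Carrier
    _≤_     : Carrier → Carrier → Set ℓ₂
    isCommutativeRing : IsCommutativeRing _≈_ _+_ _*_ -_ 0# 1#
    isTotalOrder      : IsTotalOrder _≈_ _≤_
    0≉1     : ¬ (0# ≈ 1#)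
    inverse : ∀ x → ¬ (x ≈ 0#) → ∃ λ y → x * y ≈ 1#
    +-mono-≤ : ∀ {x y} z → x ≤ y → x + z ≤ y + z
    *-nonneg : ∀ {x y} → 0# ≤ x → 0# ≤ y → 0# ≤ x * y

  _<_ : Carrier → Carrier → Set (ℓ₁ ⊔ ℓ₂)
  x < y = x ≤ y × ¬ (x ≈ y)

module _ {c ℓ₁ ℓ₂} (F : OrderedField c ℓ₁ ℓ₂) where
  open OrderedField F

  Vec3 : Set c
  Vec3 = Fin 3 → Carrier

  _≈v_ : Vec3 → Vec3 → Set ℓ₁
  x ≈v y = ∀ j → x j ≈ y j

  zeroV : Vec3
  zeroV _ = 0#

  negV : Vec3 → Vec3
  negV x j = - (x j)

  _+v_ : Vec3 → Vec3 → Vec3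
  (x +v y) j = x j + y j

  _·_ : Carrier → Vec3 → Vec3
  (a · x) j = a * x j

  sumF : ∀ k → (Fin k → Carrier) → Carrier
  sumF zero    f = 0#
  sumF (ℕ.suc k) f = f zero + sumF k (f ∘ suc)

  linComb : ∀ {k} → (Fin k → Carrier) → (Fin k → Vec3) → Vec3
  linComb {k} a w j = sumF k (λ i → a i * w i j)

  LinIndep : ∀ k → (Fin k → Vec3) → Set (c ⊔ ℓ₁)
  LinIndep k w = ∀ (a : Fin k → Carrier) → linComb a w ≈v zeroV → ∀ i → a i ≈ 0#

  Spans : ∀ k → (Fin k → Vec3) → Set (c ⊔ ℓ₁)
  Spans k w = ∀ (x : Vec3) → ∃ λ (a : Fin k → Carrier) → x ≈v linComb a w

  IsBasis : (Fin 3 → Vec3) → Set (c ⊔ ℓ₁)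
  IsBasis w = LinIndep 3 w × Spans 3 w

  PosComb : ∀ {k} → Vec3 → (Fin k → Vec3) → Set (c ⊔ ℓ₁ ⊔ ℓ₂)
  PosComb {k} x w = ∃ λ (a : Fin k → Carrier) → (∀ i → 0# < a i) × (x ≈v linComb a w)

  -- Normal systems: lines L_i = span(v_i), i < n, such that every subset
  -- of {v_1,…,v_n} of size at most 3 is linearly independent.

  IsNormalSystem : ∀ n → (Fin n → Vec3) → Set (c ⊔ ℓ₁)
  IsNormalSystem n v =
    ∀ k → k ℕ.≤ 3 → (f : Fin k → Fin n) → Injective _≡_ _≡_ f → LinIndep k (v ∘ f)

  -- The set U = {±v_1,…,±v_n}: the element (i , true) is v_i and
  -- (i , false) is -v_i.
  U : ℕ → Set
  U n = Fin n × Bool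

  vecU : ∀ {n} → (Fin n → Vec3) → U n → Vec3
  vecU v (i , true)  = v i
  vecU v (i , false) = negV (v i)

  negU : ∀ {n} → U n → U n
  negU (i , s) = (i , not s)

  IsConvexPositiveBijection : ∀ {n₁ n₂} (v₁ : Fin n₁ → Vec3) (v₂ : Fin n₂ → Vec3)
    → (U n₁ → U n₂) → Set (c ⊔ ℓ₁ ⊔ ℓ₂)
  IsConvexPositiveBijection {n₁} v₁ v₂ δ =
    Bijective _≡_ _≡_ δ
    × (∀ u → δ (negU u) ≡ negU (δ u))
    × (∀ (b : Fin 3 → U n₁) → IsBasis (vecU v₁ ∘ b) → ∀ (u : U n₁) →
         PosComb (vecU v₁ u) (vecU v₁ ∘ b) ⇔ PosComb (vecU v₂ (δ u)) (vecU v₂ ∘ δ ∘ b))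

  -- Graph of compatible pairs. A vertex {x,y} is represented by an ordered
  -- pair (x , y) with x ≠ ±y; two ordered pairs represent the same vertex
  -- iff they agree as unordered pairs (SamePair).

  Pair : ℕ → Set
  Pair n = U n × U n

  IsVertex : ∀ {n} → Pair n → Set
  IsVertex (x , y) = x ≢ y × x ≢ negU y

  SamePair : ∀ {n} → Pair n → Pair n → Set
  SamePair (x , y) (x' , y') = (x ≡ x' × y ≡ y') ⊎ (x ≡ y' × y ≡ x')

  Adjacent : ∀ {n} → (Fin n → Vec3) → Pair n → Pair n → Set (c ⊔ ℓ₁ ⊔ ℓ₂)
  Adjacent v p@(x₁ , y₁) q@(x₂ , y₂) =
    ¬ SamePair p q ×
    ∃ λ a → ∃ λ b → ∃ λ c' → ∃ λ d →
      0# < a × 0# < b × 0# < c' × 0# < d ×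
      ((a · vecU v x₁) +v (b · vecU v y₁)) ≈v ((c' · vecU v x₂) +v (d · vecU v y₂))

  IsGraphIso : ∀ {n₁ n₂} (v₁ : Fin n₁ → Vec3) (v₂ : Fin n₂ → Vec3)
    → (Pair n₁ → Pair n₂) → Set (c ⊔ ℓ₁ ⊔ ℓ₂)
  IsGraphIso {n₁} {n₂} v₁ v₂ φ =
    (∀ p → IsVertex p → IsVertex (φ p))
    × (∀ p q → IsVertex p → IsVertex q → SamePair p q → SamePair (φ p) (φ q))
    × (∀ p q → IsVertex p → IsVertex q → SamePair (φ p) (φ q) → SamePair p q)
    × (∀ q → IsVertex q → ∃ λ p → IsVertex p × SamePair (φ p) q)
    × (∀ p q → IsVertex p → IsVertex q → Adjacent v₁ p q ⇔ Adjacent v₂ (φ p) (φ q))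

  inducedMap : ∀ {n₁ n₂} → (U n₁ → U n₂) → Pair n₁ → Pair n₂
  inducedMap δ (x , y) = (δ x , δ y)

module Submission where

-- Two compatible pairs {x₁,y₁} and {x₂,y₂} are adjacent exactly when x₁ is a positive combination
-- of x₂, y₂, −y₁: solve a x₁ + b y₁ = c x₂ + d y₂ for x₁.  In a normal system these three vectors
-- lie on distinct lines, so they form a basis, and a convex positive bijection therefore carries
-- edges to edges and non-edges to non-edges.  Conversely, u = a₀ b₀ + a₁ b₁ + a₂ b₂ with all aᵢ > 0
-- says exactly that {u, −b₂} and {b₀, b₁} are adjacent, so a graph isomorphism induced by δ carries
-- positive combinations over bases to positive combinations.  The only linear algebra needed is
-- that three independent vectors span F³, which is Cramer's rule once the determinant is known to
-- be nonzero.

open import Level using (Level; _⊔_)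
open import Data.Bool using (Bool; true; false)
import Data.Bool.Properties as Bool
open import Data.Empty using (⊥; ⊥-elim)
open import Data.Fin as Fin using (Fin; zero; suc)
open import Data.Fin.Patterns using (0F; 1F; 2F)
open import Data.Integer as ℤ using (ℤ; +_; -[1+_]; _⊖_)
import Data.Integer.Properties as ℤ
open import Data.Maybe using (Maybe; map)
open import Data.Nat as ℕ using (ℕ; zero; suc; s≤s; z≤n)
import Data.Nat.Properties as ℕ
open import Data.Product as Product using (∃; _×_; _,_; proj₁; proj₂)
open import Data.Sign as Sign using (Sign)
open import Data.Sum as Sum using (_⊎_; inj₁; inj₂)
open import Data.Vec.Functional using ([]; _∷_)
open import Data.Vec.N-ary using (N-ary)
open import Function.Base using (_∘_; case_of_)
open import Function.Bundles using (_⇔_; mk⇔; Equivalence)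
open import Function.Definitions using (Injective; Surjective; Bijective)
open import Relation.Nullary using (¬_; yes; no)
open import Relation.Binary.Consequences using (dec⇒weaklyDec)
open import Relation.Binary.PropositionalEquality as ≡ using (_≡_; _≢_)
open import Relation.Binary.Structures using (IsTotalOrder)
open import Algebra.Bundles using (CommutativeRing)
import Algebra.Solver.Ring
open import Algebra.Solver.Ring.AlmostCommutativeRing using (fromCommutativeRing; _-Raw-AlmostCommutative⟶_)
open import Defs

injective₂ : ∀ {a} {A : Set a} (f : Fin 2 → A) → f 0F ≢ f 1F → Injective _≡_ _≡_ f
injective₂ f f₀≢f₁ {0F} {0F} _ = ≡.refl
injective₂ f f₀≢f₁ {0F} {1F} e = ⊥-elim (f₀≢f₁ e)
injective₂ f f₀≢f₁ {1F} {0F} e = ⊥-elim (f₀≢f₁ (≡.sym e))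
injective₂ f f₀≢f₁ {1F} {1F} _ = ≡.refl

injective₃ : ∀ {a} {A : Set a} (f : Fin 3 → A) → f 0F ≢ f 1F → f 0F ≢ f 2F → f 1F ≢ f 2F → Injective _≡_ _≡_ f
injective₃ f f₀≢f₁ f₀≢f₂ f₁≢f₂ {0F} {0F} _ = ≡.refl
injective₃ f f₀≢f₁ f₀≢f₂ f₁≢f₂ {0F} {1F} e = ⊥-elim (f₀≢f₁ e)
injective₃ f f₀≢f₁ f₀≢f₂ f₁≢f₂ {0F} {2F} e = ⊥-elim (f₀≢f₂ e)
injective₃ f f₀≢f₁ f₀≢f₂ f₁≢f₂ {1F} {0F} e = ⊥-elim (f₀≢f₁ (≡.sym e))
injective₃ f f₀≢f₁ f₀≢f₂ f₁≢f₂ {1F} {1F} _ = ≡.refl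
injective₃ f f₀≢f₁ f₀≢f₂ f₁≢f₂ {1F} {2F} e = ⊥-elim (f₁≢f₂ e)
injective₃ f f₀≢f₁ f₀≢f₂ f₁≢f₂ {2F} {0F} e = ⊥-elim (f₀≢f₂ (≡.sym e))
injective₃ f f₀≢f₁ f₀≢f₂ f₁≢f₂ {2F} {1F} e = ⊥-elim (f₁≢f₂ (≡.sym e))
injective₃ f f₀≢f₁ f₀≢f₂ f₁≢f₂ {2F} {2F} _ = ≡.refl

-- R need not have decidable equality, so polynomials are normalised with integer coefficients
-- and interpreted in R along the canonical map ℤ → R.
module IntegerCoefficientSolver {c ℓ} (R : CommutativeRing c ℓ) where
  open CommutativeRing R
  open import Algebra.Properties.Ring ring using (-1*x≈-x; -0#≈0#)
  open import Algebra.Properties.AbelianGroup +-abelianGroup using (⁻¹-∙-comm; ⁻¹-involutive)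
  open import Algebra.Properties.CommutativeSemigroup +-commutativeSemigroup using () renaming (interchange to +-interchange)
  open import Algebra.Properties.CommutativeSemigroup *-commutativeSemigroup using () renaming (interchange to *-interchange)
  open import Algebra.Properties.Semiring.Mult.TCOptimised semiring using (×-homo-+; ×1-homo-*) renaming (_×_ to _×′_)
  open import Relation.Binary.Reasoning.Setoid setoid

  ⟦_⟧ℤ : ℤ → Carrier
  ⟦ + n ⟧ℤ      = n ×′ 1#
  ⟦ -[1+ n ] ⟧ℤ = - (suc n ×′ 1#)

  x-0≈x : ∀ x → x - 0# ≈ x
  x-0≈x x = trans (+-congˡ -0#≈0#) (+-identityʳ x)

  suc×1≈1+ : ∀ n → suc n ×′ 1# ≈ 1# + n ×′ 1#
  suc×1≈1+ n = ×-homo-+ 1# 1 n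

  x+y-[x+z]≈y-z : ∀ x y z → (x + y) - (x + z) ≈ y - z
  x+y-[x+z]≈y-z x y z = begin
    (x + y) - (x + z)       ≈⟨ +-congˡ (⁻¹-∙-comm x z) ⟨
    (x + y) + (- x + - z)   ≈⟨ +-interchange x y (- x) (- z) ⟩
    (x - x) + (y - z)       ≈⟨ +-congʳ (-‿inverseʳ x) ⟩
    0# + (y - z)            ≈⟨ +-identityˡ _ ⟩
    y - z                   ∎

  ⊖-homo : ∀ m n → ⟦ m ⊖ n ⟧ℤ ≈ m ×′ 1# - n ×′ 1#
  ⊖-homo zero    zero    = sym (x-0≈x 0#)
  ⊖-homo zero    (suc n) = sym (+-identityˡ _)
  ⊖-homo (suc m) zero    = sym (x-0≈x _)
  ⊖-homo (suc m) (suc n) = begin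
    ⟦ suc m ⊖ suc n ⟧ℤ                ≡⟨ ≡.cong ⟦_⟧ℤ (ℤ.[1+m]⊖[1+n]≡m⊖n m n) ⟩
    ⟦ m ⊖ n ⟧ℤ                        ≈⟨ ⊖-homo m n ⟩
    m ×′ 1# - n ×′ 1#                 ≈⟨ x+y-[x+z]≈y-z 1# _ _ ⟨
    (1# + m ×′ 1#) - (1# + n ×′ 1#)   ≈⟨ +-cong (suc×1≈1+ m) (-‿cong (suc×1≈1+ n)) ⟨
    suc m ×′ 1# - suc n ×′ 1#         ∎

  +-homo : ∀ i j → ⟦ i ℤ.+ j ⟧ℤ ≈ ⟦ i ⟧ℤ + ⟦ j ⟧ℤ
  +-homo (+ m)    (+ n)    = ×-homo-+ 1# m n
  +-homo (+ m)    -[1+ n ] = ⊖-homo m (suc n)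
  +-homo -[1+ m ] (+ n)    = trans (⊖-homo n (suc m)) (+-comm _ _)
  +-homo -[1+ m ] -[1+ n ] = begin
    - (suc (suc (m ℕ.+ n)) ×′ 1#)       ≡⟨ ≡.cong (λ k → - (k ×′ 1#)) (ℕ.+-suc (suc m) n) ⟨
    - ((suc m ℕ.+ suc n) ×′ 1#)         ≈⟨ -‿cong (×-homo-+ 1# (suc m) (suc n)) ⟩
    - (suc m ×′ 1# + suc n ×′ 1#)       ≈⟨ ⁻¹-∙-comm _ _ ⟨
    - (suc m ×′ 1#) + - (suc n ×′ 1#)   ∎

  ⟦_⟧ₛ : Sign → Carrier
  ⟦ Sign.+ ⟧ₛ = 1#
  ⟦ Sign.- ⟧ₛ = - 1#

  *-homoₛ : ∀ s t → ⟦ s Sign.* t ⟧ₛ ≈ ⟦ s ⟧ₛ * ⟦ t ⟧ₛ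
  *-homoₛ Sign.+ t      = sym (*-identityˡ _)
  *-homoₛ Sign.- Sign.+ = sym (*-identityʳ _)
  *-homoₛ Sign.- Sign.- = sym (trans (-1*x≈-x (- 1#)) (⁻¹-involutive 1#))

  ◃-homo : ∀ s n → ⟦ s ℤ.◃ n ⟧ℤ ≈ ⟦ s ⟧ₛ * (n ×′ 1#)
  ◃-homo s      zero    = sym (zeroʳ _)
  ◃-homo Sign.+ (suc n) = sym (*-identityˡ _)
  ◃-homo Sign.- (suc n) = sym (-1*x≈-x _)

  sign-abs-homo : ∀ i → ⟦ i ⟧ℤ ≈ ⟦ ℤ.sign i ⟧ₛ * (ℤ.∣ i ∣ ×′ 1#)
  sign-abs-homo i = trans (reflexive (≡.cong ⟦_⟧ℤ (≡.sym (ℤ.◃-inverse i)))) (◃-homo (ℤ.sign i) ℤ.∣ i ∣)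

  *-homo : ∀ i j → ⟦ i ℤ.* j ⟧ℤ ≈ ⟦ i ⟧ℤ * ⟦ j ⟧ℤ
  *-homo i j = begin
    ⟦ i ℤ.* j ⟧ℤ                                                        ≈⟨ ◃-homo (ℤ.sign i Sign.* ℤ.sign j) (ℤ.∣ i ∣ ℕ.* ℤ.∣ j ∣) ⟩
    ⟦ ℤ.sign i Sign.* ℤ.sign j ⟧ₛ * ((ℤ.∣ i ∣ ℕ.* ℤ.∣ j ∣) ×′ 1#)        ≈⟨ *-cong (*-homoₛ (ℤ.sign i) (ℤ.sign j)) (×1-homo-* ℤ.∣ i ∣ ℤ.∣ j ∣) ⟩
    (⟦ ℤ.sign i ⟧ₛ * ⟦ ℤ.sign j ⟧ₛ) * ((ℤ.∣ i ∣ ×′ 1#) * (ℤ.∣ j ∣ ×′ 1#)) ≈⟨ *-interchange _ _ _ _ ⟩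
    (⟦ ℤ.sign i ⟧ₛ * (ℤ.∣ i ∣ ×′ 1#)) * (⟦ ℤ.sign j ⟧ₛ * (ℤ.∣ j ∣ ×′ 1#)) ≈⟨ *-cong (sign-abs-homo i) (sign-abs-homo j) ⟨
    ⟦ i ⟧ℤ * ⟦ j ⟧ℤ                                                     ∎

  -‿homo : ∀ i → ⟦ ℤ.- i ⟧ℤ ≈ - ⟦ i ⟧ℤ
  -‿homo (+ zero)  = sym -0#≈0#
  -‿homo (+ suc n) = refl
  -‿homo -[1+ n ]  = sym (⁻¹-involutive _)

  homomorphism : ℤ.+-*-rawRing -Raw-AlmostCommutative⟶ fromCommutativeRing R
  homomorphism = record
    { ⟦_⟧    = ⟦_⟧ℤ
    ; +-homo = +-homo
    ; *-homo = *-homo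
    ; -‿homo = -‿homo
    ; 0-homo = refl
    ; 1-homo = refl
    }

  ≈-weaklyDecidable : ∀ i j → Maybe (⟦ i ⟧ℤ ≈ ⟦ j ⟧ℤ)
  ≈-weaklyDecidable i j = map (λ { ≡.refl → refl }) (dec⇒weaklyDec ℤ._≟_ i j)

  open Algebra.Solver.Ring ℤ.+-*-rawRing (fromCommutativeRing R) homomorphism ≈-weaklyDecidable public

module OrderedFieldProperties {c ℓ₁ ℓ₂} (F : OrderedField c ℓ₁ ℓ₂) where
  open OrderedField F

  commutativeRing : CommutativeRing c ℓ₁
  commutativeRing = record { isCommutativeRing = isCommutativeRing }

  open CommutativeRing commutativeRing public
    using ( setoid; refl; sym; trans; reflexive; _-_
          ; +-cong; +-congˡ; +-congʳ; +-comm; +-identityˡ; -‿cong; -‿inverseʳ; -‿inverseˡ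
          ; *-cong; *-congˡ; *-congʳ; *-assoc; *-comm; *-identityˡ; distribˡ; zeroˡ; zeroʳ)
  open CommutativeRing commutativeRing using (ring; +-group)
  open import Algebra.Properties.Ring ring public using (-‿distribʳ-*; -1*x≈-x; -0#≈0#)
  open import Algebra.Properties.Group +-group public using (⁻¹-involutive; x∙y⁻¹≈ε⇒x≈y; x≈y⇒x∙y⁻¹≈ε)
  open IntegerCoefficientSolver commutativeRing public using (solve; _:+_; _:*_; :-_; _:-_; _:=_; con; Polynomial)
  open IsTotalOrder isTotalOrder using (total; antisym; ≲-respˡ-≈; ≲-respʳ-≈)
  open import Relation.Binary.Reasoning.Setoid setoid

  1≉0 : ¬ (1# ≈ 0#)
  1≉0 1≈0 = 0≉1 (sym 1≈0)

  0<x⇒x≉0 : ∀ {x} → 0# < x → ¬ (x ≈ 0#)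
  0<x⇒x≉0 (_ , 0≉x) x≈0 = 0≉x (sym x≈0)

  x≤0⇒0≤-x : ∀ {x} → x ≤ 0# → 0# ≤ - x
  x≤0⇒0≤-x {x} x≤0 = ≲-respʳ-≈ (+-identityˡ (- x)) (≲-respˡ-≈ (-‿inverseʳ x) (+-mono-≤ (- x) x≤0))

  0≤x⇒-x≤0 : ∀ {x} → 0# ≤ x → - x ≤ 0#
  0≤x⇒-x≤0 {x} 0≤x = ≲-respˡ-≈ (+-identityˡ (- x)) (≲-respʳ-≈ (-‿inverseʳ x) (+-mono-≤ (- x) 0≤x))

  -1*-1≈1 : - 1# * - 1# ≈ 1#
  -1*-1≈1 = trans (-1*x≈-x (- 1#)) (⁻¹-involutive 1#)

  0<1 : 0# < 1#
  0<1 = 0≤1 , 0≉1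
    where
    0≤1 : 0# ≤ 1#
    0≤1 with total 0# 1#
    ... | inj₁ 0≤1 = 0≤1
    ... | inj₂ 1≤0 = ≲-respʳ-≈ -1*-1≈1 (*-nonneg (x≤0⇒0≤-x 1≤0) (x≤0⇒0≤-x 1≤0))

  x*y≈1⇒z≈y*[x*z] : ∀ {x y} → x * y ≈ 1# → ∀ z → z ≈ y * (x * z)
  x*y≈1⇒z≈y*[x*z] {x} {y} xy≈1 z = begin
    z              ≈⟨ *-identityˡ z ⟨
    1# * z         ≈⟨ *-congʳ xy≈1 ⟨
    (x * y) * z    ≈⟨ solve 3 (λ x y z → (x :* y) :* z := y :* (x :* z)) refl x y z ⟩
    y * (x * z)    ∎

  x≉0⇒x*y≈0⇒y≈0 : ∀ {x y} → ¬ (x ≈ 0#) → x * y ≈ 0# → y ≈ 0#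
  x≉0⇒x*y≈0⇒y≈0 {x} {y} x≉0 xy≈0 with inverse x x≉0
  ... | x⁻¹ , xx⁻¹≈1 = trans (x*y≈1⇒z≈y*[x*z] xx⁻¹≈1 y) (trans (*-congˡ xy≈0) (zeroʳ x⁻¹))

  pos*pos⇒pos : ∀ {x y} → 0# < x → 0# < y → 0# < (x * y)
  pos*pos⇒pos 0<x 0<y =
    *-nonneg (proj₁ 0<x) (proj₁ 0<y) ,
    λ 0≈xy → 0<x⇒x≉0 0<y (x≉0⇒x*y≈0⇒y≈0 (0<x⇒x≉0 0<x) (sym 0≈xy))

  pos⇒pos⁻¹ : ∀ {x} → 0# < x → ∃ λ y → 0# < y × x * y ≈ 1#
  pos⇒pos⁻¹ {x} 0<x with inverse x (0<x⇒x≉0 0<x)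
  ... | y , xy≈1 = y , 0<y , xy≈1
    where
    0≤-1⇒⊥ : 0# ≤ - 1# → ⊥
    0≤-1⇒⊥ 0≤-1 = 1≉0 (begin
      1#        ≈⟨ ⁻¹-involutive 1# ⟨
      - (- 1#)  ≈⟨ -‿cong (antisym (0≤x⇒-x≤0 (proj₁ 0<1)) 0≤-1) ⟩
      - 0#      ≈⟨ -0#≈0# ⟩
      0#        ∎)
    0<y : 0# < y
    0<y with total 0# y
    ... | inj₁ 0≤y = 0≤y , λ 0≈y → 1≉0 (trans (sym xy≈1) (trans (*-congˡ (sym 0≈y)) (zeroʳ x)))
    ... | inj₂ y≤0 = ⊥-elim (0≤-1⇒⊥
          (≲-respʳ-≈ (trans (sym (-‿distribʳ-* x y)) (-‿cong xy≈1)) (*-nonneg (proj₁ 0<x) (x≤0⇒0≤-x y≤0))))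

  pos≉-pos : ∀ {x y} → 0# < x → 0# < y → ¬ (x ≈ - y)
  pos≉-pos {x} {y} 0<x 0<y x≈-y = 0<x⇒x≉0 0<y (antisym y≤0 (proj₁ 0<y))
    where
    y≤0 : y ≤ 0#
    y≤0 = ≲-respʳ-≈ (trans (+-congʳ x≈-y) (-‿inverseˡ y)) (≲-respˡ-≈ (+-identityˡ y) (+-mono-≤ y (proj₁ 0<x)))

module ThreeSpace {c ℓ₁ ℓ₂} (F : OrderedField c ℓ₁ ℓ₂) where
  open OrderedField F
  open OrderedFieldProperties F
  open import Relation.Binary.Reasoning.Setoid setoid

  sumF-cong : ∀ k {f g : Fin k → Carrier} → (∀ i → f i ≈ g i) → sumF F k f ≈ sumF F k g
  sumF-cong zero    f≈g = refl
  sumF-cong (suc k) f≈g = +-cong (f≈g 0F) (sumF-cong k (f≈g ∘ suc))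

  posComb-respʳ : ∀ {x} {w w′ : Fin 3 → Vec3 F} → (∀ i → _≈v_ F (w i) (w′ i)) → PosComb F x w → PosComb F x w′
  posComb-respʳ w≈w′ (a , 0<a , x≈aw) = a , 0<a , λ j → trans (x≈aw j) (sumF-cong 3 λ i → *-congˡ {a i} (w≈w′ i j))

  linComb-*ˡ : ∀ {k} t (a : Fin k → Carrier) w j → linComb F (λ i → t * a i) w j ≈ t * linComb F a w j
  linComb-*ˡ {zero}  t a w j = sym (zeroʳ t)
  linComb-*ˡ {suc k} t a w j = begin
    t * a 0F * w 0F j + linComb F (λ i → t * a (suc i)) (w ∘ suc) j
      ≈⟨ +-cong (*-assoc t (a 0F) (w 0F j)) (linComb-*ˡ t (a ∘ suc) (w ∘ suc) j) ⟩
    t * (a 0F * w 0F j) + t * linComb F (a ∘ suc) (w ∘ suc) j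
      ≈⟨ distribˡ t _ _ ⟨
    t * linComb F a w j ∎

  det : Vec3 F → Vec3 F → Vec3 F → Carrier
  det a b c = a 0F * (b 1F * c 2F - b 2F * c 1F)
            + a 1F * (b 2F * c 0F - b 0F * c 2F)
            + a 2F * (b 0F * c 1F - b 1F * c 0F)

  :det : ∀ {n} (a₀ a₁ a₂ b₀ b₁ b₂ c₀ c₁ c₂ : Polynomial n) → Polynomial n
  :det a₀ a₁ a₂ b₀ b₁ b₂ c₀ c₁ c₂ =
    a₀ :* (b₁ :* c₂ :- b₂ :* c₁) :+ a₁ :* (b₂ :* c₀ :- b₀ :* c₂) :+ a₂ :* (b₀ :* c₁ :- b₁ :* c₀)

  unit : Fin 3 → Vec3 F
  unit 0F = 1# ∷ 0# ∷ 0# ∷ []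
  unit 1F = 0# ∷ 1# ∷ 0# ∷ []
  unit 2F = 0# ∷ 0# ∷ 1# ∷ []

  cramerCoefficients : (Fin 3 → Vec3 F) → Vec3 F → Fin 3 → Carrier
  cramerCoefficients w x = det x (w 1F) (w 2F) ∷ det (w 0F) x (w 2F) ∷ det (w 0F) (w 1F) x ∷ []

  cramerIdentity : (pick : Polynomial 12 → Polynomial 12 → Polynomial 12 → Polynomial 12)
                 → N-ary 12 (Polynomial 12) (Polynomial 12 × Polynomial 12)
  cramerIdentity pick a₀ a₁ a₂ b₀ b₁ b₂ c₀ c₁ c₂ x₀ x₁ x₂ =
    :det a₀ a₁ a₂ b₀ b₁ b₂ c₀ c₁ c₂ :* pick x₀ x₁ x₂
    := :det x₀ x₁ x₂ b₀ b₁ b₂ c₀ c₁ c₂ :* pick a₀ a₁ a₂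
    :+ (:det a₀ a₁ a₂ x₀ x₁ x₂ c₀ c₁ c₂ :* pick b₀ b₁ b₂
    :+ (:det a₀ a₁ a₂ b₀ b₁ b₂ x₀ x₁ x₂ :* pick c₀ c₁ c₂ :+ con (+ 0)))

  cramer : ∀ w x j → det (w 0F) (w 1F) (w 2F) * x j ≈ linComb F (cramerCoefficients w x) w j
  cramer w x j = cramerAt j
    where
    a₀ = w 0F 0F; a₁ = w 0F 1F; a₂ = w 0F 2F
    b₀ = w 1F 0F; b₁ = w 1F 1F; b₂ = w 1F 2F
    c₀ = w 2F 0F; c₁ = w 2F 1F; c₂ = w 2F 2F
    x₀ = x 0F;    x₁ = x 1F;    x₂ = x 2F
    cramerAt : ∀ j → det (w 0F) (w 1F) (w 2F) * x j ≈ linComb F (cramerCoefficients w x) w j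
    cramerAt 0F = solve 12 (cramerIdentity λ p₀ _ _ → p₀) refl a₀ a₁ a₂ b₀ b₁ b₂ c₀ c₁ c₂ x₀ x₁ x₂
    cramerAt 1F = solve 12 (cramerIdentity λ _ p₁ _ → p₁) refl a₀ a₁ a₂ b₀ b₁ b₂ c₀ c₁ c₂ x₀ x₁ x₂
    cramerAt 2F = solve 12 (cramerIdentity λ _ _ p₂ → p₂) refl a₀ a₁ a₂ b₀ b₁ b₂ c₀ c₁ c₂ x₀ x₁ x₂

  det-units : ∀ x → det x (unit 1F) (unit 2F) ≈ x 0F × det x (unit 2F) (unit 0F) ≈ x 1F × det x (unit 0F) (unit 1F) ≈ x 2F
  det-units x =
    solve 3 (λ x₀ x₁ x₂ → :det x₀ x₁ x₂ 𝟘 𝟙 𝟘 𝟘 𝟘 𝟙 := x₀) refl (x 0F) (x 1F) (x 2F) ,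
    solve 3 (λ x₀ x₁ x₂ → :det x₀ x₁ x₂ 𝟘 𝟘 𝟙 𝟙 𝟘 𝟘 := x₁) refl (x 0F) (x 1F) (x 2F) ,
    solve 3 (λ x₀ x₁ x₂ → :det x₀ x₁ x₂ 𝟙 𝟘 𝟘 𝟘 𝟙 𝟘 := x₂) refl (x 0F) (x 1F) (x 2F)
    where
    𝟘 𝟙 : Polynomial 3
    𝟘 = con (+ 0)
    𝟙 = con (+ 1)

  linIndep⇒det≉0 : ∀ w → LinIndep F 3 w → ¬ (det (w 0F) (w 1F) (w 2F) ≈ 0#)
  linIndep⇒det≉0 w independent det≈0 = 1≉0 (independent (1# ∷ 0# ∷ 0# ∷ []) w₀-relation 0F)
    where
    cofactor≈0 : ∀ x i → cramerCoefficients w x i ≈ 0#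
    cofactor≈0 x = independent (cramerCoefficients w x) λ j → begin
      linComb F (cramerCoefficients w x) w j   ≈⟨ cramer w x j ⟨
      det (w 0F) (w 1F) (w 2F) * x j           ≈⟨ *-congʳ det≈0 ⟩
      0# * x j                                 ≈⟨ zeroˡ (x j) ⟩
      0#                                       ∎
    -- By cofactor≈0, Cramer's rule for the triple (w₀, w₁, eₗ) at eₖ is a relation between w₀ and w₁;
    -- its coefficient of w₁ is, up to sign, an entry of w₀.
    minor≈0 : ∀ k l → det (w 0F) (unit k) (unit l) ≈ 0#
    minor≈0 k l = independent r relation 1F
      where
      r : Fin 3 → Carrier
      r = det (unit k) (w 1F) (unit l) ∷ det (w 0F) (unit k) (unit l) ∷ 0# ∷ []
      w′ : Fin 3 → Vec3 F
      w′ = w 0F ∷ w 1F ∷ unit l ∷ []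
      relation : _≈v_ F (linComb F r w) (zeroV F)
      relation j = begin
        linComb F r w j
          ≈⟨ +-congˡ (+-congˡ (+-congʳ (trans (zeroˡ (w 2F j)) (sym (trans (*-congʳ (cofactor≈0 (unit k) 2F)) (zeroˡ _)))))) ⟩
        linComb F (cramerCoefficients w′ (unit k)) w′ j   ≈⟨ cramer w′ (unit k) j ⟨
        det (w 0F) (w 1F) (unit l) * unit k j             ≈⟨ *-congʳ (cofactor≈0 (unit l) 2F) ⟩
        0# * unit k j                                     ≈⟨ zeroˡ (unit k j) ⟩
        0#                                                ∎
    w₀≈0 : ∀ j → w 0F j ≈ 0#
    w₀≈0 0F = trans (sym (proj₁ (det-units (w 0F)))) (minor≈0 1F 2F)
    w₀≈0 1F = trans (sym (proj₁ (proj₂ (det-units (w 0F))))) (minor≈0 2F 0F)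
    w₀≈0 2F = trans (sym (proj₂ (proj₂ (det-units (w 0F))))) (minor≈0 0F 1F)
    w₀-relation : _≈v_ F (linComb F (1# ∷ 0# ∷ 0# ∷ []) w) (zeroV F)
    w₀-relation j = trans
      (solve 3 (λ a b c → con (+ 1) :* a :+ (con (+ 0) :* b :+ (con (+ 0) :* c :+ con (+ 0))) := a) refl (w 0F j) (w 1F j) (w 2F j))
      (w₀≈0 j)

  linIndep⇒spans : ∀ w → LinIndep F 3 w → Spans F 3 w
  linIndep⇒spans w independent x with inverse (det (w 0F) (w 1F) (w 2F)) (linIndep⇒det≉0 w independent)
  ... | d⁻¹ , dd⁻¹≈1 = (λ i → d⁻¹ * cramerCoefficients w x i) , λ j → begin
    x j                                                      ≈⟨ x*y≈1⇒z≈y*[x*z] dd⁻¹≈1 (x j) ⟩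
    d⁻¹ * (det (w 0F) (w 1F) (w 2F) * x j)                   ≈⟨ *-congˡ (cramer w x j) ⟩
    d⁻¹ * linComb F (cramerCoefficients w x) w j             ≈⟨ linComb-*ˡ d⁻¹ (cramerCoefficients w x) w j ⟨
    linComb F (λ i → d⁻¹ * cramerCoefficients w x i) w j     ∎

  linIndep⇒basis : ∀ w → LinIndep F 3 w → IsBasis F w
  linIndep⇒basis w independent = independent , linIndep⇒spans w independent

module SignedVectors {c ℓ₁ ℓ₂} (F : OrderedField c ℓ₁ ℓ₂) {n} (v : Fin n → Vec3 F) where
  open OrderedField F
  open OrderedFieldProperties F
  open ThreeSpace F using (linIndep⇒basis; sumF-cong; posComb-respʳ)
  open import Relation.Binary.Reasoning.Setoid setoid

  vec : U F n → Vec3 F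
  vec = vecU F v

  DistinctLines : ∀ {k} → (Fin k → U F n) → Set
  DistinctLines b = Injective _≡_ _≡_ (proj₁ ∘ b)

  negU-involutive : ∀ (u : U F n) → negU F (negU F u) ≡ u
  negU-involutive (i , s) = ≡.cong (i ,_) (Bool.not-involutive s)

  sameLine : ∀ (u w : U F n) → proj₁ u ≡ proj₁ w → u ≡ w ⊎ u ≡ negU F w
  sameLine (i , true)  (.i , true)  ≡.refl = inj₁ ≡.refl
  sameLine (i , true)  (.i , false) ≡.refl = inj₂ ≡.refl
  sameLine (i , false) (.i , true)  ≡.refl = inj₂ ≡.refl
  sameLine (i , false) (.i , false) ≡.refl = inj₁ ≡.refl

  vertex⇒lines≢ : ∀ {x y : U F n} → IsVertex F (x , y) → proj₁ x ≢ proj₁ y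
  vertex⇒lines≢ {x} {y} (x≢y , x≢-y) x∥y with sameLine x y x∥y
  ... | inj₁ x≡y  = x≢y x≡y
  ... | inj₂ x≡-y = x≢-y x≡-y

  lines≢⇒vertex : ∀ {x y : U F n} → proj₁ x ≢ proj₁ y → IsVertex F (x , y)
  lines≢⇒vertex x∦y = (λ x≡y → x∦y (≡.cong proj₁ x≡y)) , (λ x≡-y → x∦y (≡.cong proj₁ x≡-y))

  vertex-swap : ∀ {x y : U F n} → IsVertex F (x , y) → IsVertex F (y , x)
  vertex-swap {x} {y} (x≢y , x≢-y) =
    (λ y≡x → x≢y (≡.sym y≡x)) , (λ y≡-x → x≢-y (≡.trans (≡.sym (negU-involutive x)) (≡.cong (negU F) (≡.sym y≡-x))))

  vec-negU : ∀ u j → vec (negU F u) j ≈ - vec u j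
  vec-negU (i , true)  j = refl
  vec-negU (i , false) j = sym (⁻¹-involutive (v i j))

  sign : Bool → Carrier
  sign true  = 1#
  sign false = - 1#

  sign≉0 : ∀ s → ¬ (sign s ≈ 0#)
  sign≉0 true  = 1≉0
  sign≉0 false -1≈0 = 1≉0 (trans (sym (⁻¹-involutive 1#)) (trans (-‿cong -1≈0) -0#≈0#))

  vec≈sign*v : ∀ i s j → vec (i , s) j ≈ sign s * v i j
  vec≈sign*v i true  j = sym (*-identityˡ (v i j))
  vec≈sign*v i false j = sym (-1*x≈-x (v i j))

  -- The multiple is ±1, and it is 1 whenever it is a quotient of two positive numbers.
  sameLine⇒multiple : ∀ (u w : U F n) → proj₁ u ≡ proj₁ w
    → ∃ λ s → (∀ j → vec u j ≈ s * vec w j) × (∀ {a b} → 0# < a → 0# < b → a ≈ b * s → u ≡ w)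
  sameLine⇒multiple u w u∥w with sameLine u w u∥w
  ... | inj₁ ≡.refl = 1# , (λ j → sym (*-identityˡ (vec u j))) , λ _ _ _ → ≡.refl
  ... | inj₂ ≡.refl = - 1# , (λ j → trans (vec-negU w j) (sym (-1*x≈-x (vec w j)))) ,
        λ {_} {b} 0<a 0<b a≈b*-1 → ⊥-elim (pos≉-pos 0<a 0<b (trans a≈b*-1 (trans (*-comm b (- 1#)) (-1*x≈-x b))))

  adjacent⇔posComb : ∀ {x y z w : U F n} → ¬ SamePair F (x , y) (z , w)
    → Adjacent F v (x , y) (z , w) ⇔ PosComb F (vec x) (vec ∘ (z ∷ w ∷ negU F y ∷ []))
  adjacent⇔posComb {x} {y} {z} {w} ¬same = mk⇔ adjacent⇒posComb posComb⇒adjacent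
    where
    adjacent⇒posComb : Adjacent F v (x , y) (z , w) → PosComb F (vec x) (vec ∘ (z ∷ w ∷ negU F y ∷ []))
    adjacent⇒posComb (_ , a , b , c , d , 0<a , 0<b , 0<c , 0<d , ax+by≈cz+dw) with pos⇒pos⁻¹ 0<a
    ... | a⁻¹ , 0<a⁻¹ , aa⁻¹≈1 = c * a⁻¹ ∷ d * a⁻¹ ∷ b * a⁻¹ ∷ [] , positive , λ j → begin
      vec x j
        ≈⟨ x*y≈1⇒z≈y*[x*z] aa⁻¹≈1 (vec x j) ⟩
      a⁻¹ * (a * vec x j)
        ≈⟨ *-congˡ (solve 4 (λ a b X Y → a :* X := a :* X :+ b :* Y :- b :* Y) refl a b (vec x j) (vec y j)) ⟩
      a⁻¹ * (a * vec x j + b * vec y j - b * vec y j)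
        ≈⟨ *-congˡ (+-congʳ (ax+by≈cz+dw j)) ⟩
      a⁻¹ * (c * vec z j + d * vec w j - b * vec y j)
        ≈⟨ solve 7 (λ a⁻¹ b c d Y Z W → a⁻¹ :* (c :* Z :+ d :* W :- b :* Y)
                     := c :* a⁻¹ :* Z :+ (d :* a⁻¹ :* W :+ (b :* a⁻¹ :* (:- Y) :+ con (+ 0))))
                   refl a⁻¹ b c d (vec y j) (vec z j) (vec w j) ⟩
      c * a⁻¹ * vec z j + (d * a⁻¹ * vec w j + (b * a⁻¹ * - vec y j + 0#))
        ≈⟨ +-congˡ (+-congˡ (+-congʳ (*-congˡ (vec-negU y j)))) ⟨
      linComb F (c * a⁻¹ ∷ d * a⁻¹ ∷ b * a⁻¹ ∷ []) (vec ∘ (z ∷ w ∷ negU F y ∷ [])) j ∎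
      where
      positive : ∀ i → 0# < (c * a⁻¹ ∷ d * a⁻¹ ∷ b * a⁻¹ ∷ []) i
      positive 0F = pos*pos⇒pos 0<c 0<a⁻¹
      positive 1F = pos*pos⇒pos 0<d 0<a⁻¹
      positive 2F = pos*pos⇒pos 0<b 0<a⁻¹

    posComb⇒adjacent : PosComb F (vec x) (vec ∘ (z ∷ w ∷ negU F y ∷ [])) → Adjacent F v (x , y) (z , w)
    posComb⇒adjacent (α , 0<α , x≈αzwy) =
      ¬same , 1# , α 2F , α 0F , α 1F , 0<1 , 0<α 2F , 0<α 0F , 0<α 1F , λ j → begin
      1# * vec x j + α 2F * vec y j
        ≈⟨ +-congʳ (*-congˡ (x≈αzwy j)) ⟩
      1# * (α 0F * vec z j + (α 1F * vec w j + (α 2F * vec (negU F y) j + 0#))) + α 2F * vec y j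
        ≈⟨ +-congʳ (*-congˡ (+-congˡ (+-congˡ (+-congʳ (*-congˡ (vec-negU y j)))))) ⟩
      1# * (α 0F * vec z j + (α 1F * vec w j + (α 2F * - vec y j + 0#))) + α 2F * vec y j
        ≈⟨ solve 6 (λ α₀ α₁ α₂ Y Z W → con (+ 1) :* (α₀ :* Z :+ (α₁ :* W :+ (α₂ :* (:- Y) :+ con (+ 0)))) :+ α₂ :* Y
                     := α₀ :* Z :+ α₁ :* W)
                   refl (α 0F) (α 1F) (α 2F) (vec y j) (vec z j) (vec w j) ⟩
      α 0F * vec z j + α 1F * vec w j ∎

  adjacent-swap : ∀ {x₁ y₁ x₂ y₂ : U F n} → Adjacent F v (x₁ , y₁) (x₂ , y₂) → Adjacent F v (x₁ , y₁) (y₂ , x₂)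
  adjacent-swap (¬same , a , b , c , d , 0<a , 0<b , 0<c , 0<d , ax+by≈cz+dw) =
    ¬same ∘ Sum.swap , a , b , d , c , 0<a , 0<b , 0<d , 0<c , λ j → trans (ax+by≈cz+dw j) (+-comm _ _)

  linIndep⇒distinctLines : (b : Fin 3 → U F n) → LinIndep F 3 (vec ∘ b) → DistinctLines b
  linIndep⇒distinctLines b independent = injective₃ (proj₁ ∘ b) b₀∦b₁ b₀∦b₂ b₁∦b₂
    where
    B₀ B₁ B₂ : Fin 3 → Carrier
    B₀ = vec (b 0F); B₁ = vec (b 1F); B₂ = vec (b 2F)
    b₀∦b₁ : proj₁ (b 0F) ≢ proj₁ (b 1F)
    b₀∦b₁ e with sameLine⇒multiple (b 0F) (b 1F) e
    ... | s , b₀≈sb₁ , _ = 1≉0 (independent (1# ∷ - s ∷ 0# ∷ []) relation 0F)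
      where
      relation : ∀ j → 1# * B₀ j + (- s * B₁ j + (0# * B₂ j + 0#)) ≈ 0#
      relation j = trans
        (solve 4 (λ s X Y Z → con (+ 1) :* X :+ (:- s :* Y :+ (con (+ 0) :* Z :+ con (+ 0))) := X :- s :* Y) refl s (B₀ j) (B₁ j) (B₂ j))
        (x≈y⇒x∙y⁻¹≈ε (b₀≈sb₁ j))
    b₀∦b₂ : proj₁ (b 0F) ≢ proj₁ (b 2F)
    b₀∦b₂ e with sameLine⇒multiple (b 0F) (b 2F) e
    ... | s , b₀≈sb₂ , _ = 1≉0 (independent (1# ∷ 0# ∷ - s ∷ []) relation 0F)
      where
      relation : ∀ j → 1# * B₀ j + (0# * B₁ j + (- s * B₂ j + 0#)) ≈ 0#
      relation j = trans
        (solve 4 (λ s X Y Z → con (+ 1) :* X :+ (con (+ 0) :* Y :+ (:- s :* Z :+ con (+ 0))) := X :- s :* Z) refl s (B₀ j) (B₁ j) (B₂ j))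
        (x≈y⇒x∙y⁻¹≈ε (b₀≈sb₂ j))
    b₁∦b₂ : proj₁ (b 1F) ≢ proj₁ (b 2F)
    b₁∦b₂ e with sameLine⇒multiple (b 1F) (b 2F) e
    ... | s , b₁≈sb₂ , _ = 1≉0 (independent (0# ∷ 1# ∷ - s ∷ []) relation 1F)
      where
      relation : ∀ j → 0# * B₀ j + (1# * B₁ j + (- s * B₂ j + 0#)) ≈ 0#
      relation j = trans
        (solve 4 (λ s X Y Z → con (+ 0) :* X :+ (con (+ 1) :* Y :+ (:- s :* Z :+ con (+ 0))) := Y :- s :* Z) refl s (B₀ j) (B₁ j) (B₂ j))
        (x≈y⇒x∙y⁻¹≈ε (b₁≈sb₂ j))

  posComb⇒lines≢ : ∀ (b : Fin 3 → U F n) u → LinIndep F 3 (vec ∘ b) → PosComb F (vec u) (vec ∘ b) → proj₁ u ≢ proj₁ (b 2F)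
  posComb⇒lines≢ b u independent (a , 0<a , u≈ab) e with sameLine⇒multiple u (b 2F) e
  ... | s , u≈sb₂ , _ = 0<x⇒x≉0 (0<a 0F) (independent (a 0F ∷ a 1F ∷ a 2F - s ∷ []) relation 0F)
    where
    relation : ∀ j → a 0F * vec (b 0F) j + (a 1F * vec (b 1F) j + ((a 2F - s) * vec (b 2F) j + 0#)) ≈ 0#
    relation j = trans
      (solve 7 (λ a₀ a₁ a₂ s X Y Z → a₀ :* X :+ (a₁ :* Y :+ ((a₂ :- s) :* Z :+ con (+ 0)))
                  := (a₀ :* X :+ (a₁ :* Y :+ (a₂ :* Z :+ con (+ 0)))) :- s :* Z)
             refl (a 0F) (a 1F) (a 2F) s (vec (b 0F) j) (vec (b 1F) j) (vec (b 2F) j))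
      (x≈y⇒x∙y⁻¹≈ε (trans (sym (u≈ab j)) (u≈sb₂ j)))

  posComb-resp≡ : ∀ {x} {b b′ : Fin 3 → U F n} → (∀ i → b i ≡ b′ i) → PosComb F x (vec ∘ b) → PosComb F x (vec ∘ b′)
  posComb-resp≡ b≡b′ = posComb-respʳ λ i j → reflexive (≡.cong (λ t → vec t j) (b≡b′ i))

  distinctLines-resp≡ : ∀ {k} {b b′ : Fin k → U F n} → (∀ i → b i ≡ b′ i) → DistinctLines b → DistinctLines b′
  distinctLines-resp≡ {b = b} {b′} b≡b′ distinct {i} {j} e =
    distinct (≡.trans (≡.cong proj₁ (b≡b′ i)) (≡.trans e (≡.cong proj₁ (≡.sym (b≡b′ j)))))

  posComb⇔adjacent : ∀ (b : Fin 3 → U F n) u → LinIndep F 3 (vec ∘ b)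
    → PosComb F (vec u) (vec ∘ b) ⇔ Adjacent F v (u , negU F (b 2F)) (b 0F , b 1F)
  posComb⇔adjacent b u independent = mk⇔
    (Equivalence.from (adjacent⇔posComb ¬same) ∘ posComb-resp≡ b≡b′)
    (posComb-resp≡ (≡.sym ∘ b≡b′) ∘ Equivalence.to (adjacent⇔posComb ¬same))
    where
    distinct = linIndep⇒distinctLines b independent
    ¬same : ¬ SamePair F (u , negU F (b 2F)) (b 0F , b 1F)
    ¬same (inj₁ (_ , -b₂≡b₁)) = case distinct {1F} {2F} (≡.cong proj₁ (≡.sym -b₂≡b₁)) of λ ()
    ¬same (inj₂ (_ , -b₂≡b₀)) = case distinct {0F} {2F} (≡.cong proj₁ (≡.sym -b₂≡b₀)) of λ ()
    b≡b′ : ∀ i → b i ≡ (b 0F ∷ b 1F ∷ negU F (negU F (b 2F)) ∷ []) i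
    b≡b′ 0F = ≡.refl
    b≡b′ 1F = ≡.refl
    b≡b′ 2F = ≡.sym (negU-involutive (b 2F))

  module _ (normal : IsNormalSystem F n v) where

    distinctLines⇒linIndep : ∀ {k} → k ℕ.≤ 3 → (b : Fin k → U F n) → DistinctLines b → LinIndep F k (vec ∘ b)
    distinctLines⇒linIndep {k} k≤3 b distinct a a·b≈0 i =
      x≉0⇒x*y≈0⇒y≈0 (sign≉0 (proj₂ (b i))) (trans (*-comm _ (a i)) (normal k k≤3 (proj₁ ∘ b) distinct a′ relation i))
      where
      a′ : Fin k → Carrier
      a′ i = a i * sign (proj₂ (b i))
      relation : _≈v_ F (linComb F a′ (v ∘ proj₁ ∘ b)) (zeroV F)
      relation j = trans
        (sumF-cong k λ i → trans (*-assoc (a i) _ _) (*-congˡ (sym (vec≈sign*v (proj₁ (b i)) (proj₂ (b i)) j))))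
        (a·b≈0 j)

    distinctLines⇒basis : (b : Fin 3 → U F n) → DistinctLines b → IsBasis F (vec ∘ b)
    distinctLines⇒basis b distinct = linIndep⇒basis (vec ∘ b) (distinctLines⇒linIndep ℕ.≤-refl b distinct)

    -- If x₂ ∥ y₁, the relation a x₁ + b y₁ = c x₂ + d y₂ lives on the lines of x₁, y₁, y₂.  When these
    -- are distinct, independence forces a = 0; when y₂ ∥ x₁, comparing coefficients and signs gives
    -- x₂ = y₁ and y₂ = x₁, so the two pairs coincide.
    adjacent⇒lines≢ : ∀ {x₁ y₁ x₂ y₂ : U F n} → IsVertex F (x₁ , y₁) → IsVertex F (x₂ , y₂)
      → Adjacent F v (x₁ , y₁) (x₂ , y₂) → proj₁ x₂ ≢ proj₁ y₁
    adjacent⇒lines≢ {x₁} {y₁} {x₂} {y₂} p q (¬same , a , b , c , d , 0<a , 0<b , 0<c , 0<d , ax₁+by₁≈cx₂+dy₂) x₂∥y₁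
      with sameLine⇒multiple x₂ y₁ x₂∥y₁ | proj₁ y₂ Fin.≟ proj₁ x₁
    ... | s , x₂≈sy₁ , _ | no y₂∦x₁ =
      0<x⇒x≉0 0<a (distinctLines⇒linIndep (s≤s (s≤s (s≤s z≤n))) (x₁ ∷ y₁ ∷ y₂ ∷ []) distinct (a ∷ b - c * s ∷ - d ∷ []) relation 0F)
      where
      distinct : DistinctLines (x₁ ∷ y₁ ∷ y₂ ∷ [])
      distinct = injective₃ _ (vertex⇒lines≢ p) (y₂∦x₁ ∘ ≡.sym) (vertex⇒lines≢ q ∘ ≡.trans x₂∥y₁)
      relation : ∀ j → a * vec x₁ j + ((b - c * s) * vec y₁ j + (- d * vec y₂ j + 0#)) ≈ 0#
      relation j = trans
        (solve 8 (λ a b c d s X Y W → a :* X :+ ((b :- c :* s) :* Y :+ (:- d :* W :+ con (+ 0)))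
                    := (a :* X :+ b :* Y) :- (c :* (s :* Y) :+ d :* W))
               refl a b c d s (vec x₁ j) (vec y₁ j) (vec y₂ j))
        (x≈y⇒x∙y⁻¹≈ε (trans (ax₁+by₁≈cx₂+dy₂ j) (+-congʳ (*-congˡ (x₂≈sy₁ j)))))
    ... | s , x₂≈sy₁ , x₂≡y₁-if | yes y₂∥x₁ with sameLine⇒multiple y₂ x₁ y₂∥x₁
    ...   | t , y₂≈tx₁ , y₂≡x₁-if = ¬same (inj₂ (≡.sym (y₂≡x₁-if 0<a 0<d a≈dt) , ≡.sym (x₂≡y₁-if 0<b 0<c b≈cs)))
      where
      relation : ∀ j → (a - d * t) * vec x₁ j + ((b - c * s) * vec y₁ j + 0#) ≈ 0#
      relation j = trans
        (solve 8 (λ a b c d s t X Y → (a :- d :* t) :* X :+ ((b :- c :* s) :* Y :+ con (+ 0))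
                    := (a :* X :+ b :* Y) :- (c :* (s :* Y) :+ d :* (t :* X)))
               refl a b c d s t (vec x₁ j) (vec y₁ j))
        (x≈y⇒x∙y⁻¹≈ε (trans (ax₁+by₁≈cx₂+dy₂ j) (+-cong (*-congˡ (x₂≈sy₁ j)) (*-congˡ (y₂≈tx₁ j)))))
      coefficient≈0 = distinctLines⇒linIndep (s≤s (s≤s z≤n)) (x₁ ∷ y₁ ∷ []) (injective₂ _ (vertex⇒lines≢ p)) (a - d * t ∷ b - c * s ∷ []) relation
      a≈dt = x∙y⁻¹≈ε⇒x≈y a (d * t) (coefficient≈0 0F)
      b≈cs = x∙y⁻¹≈ε⇒x≈y b (c * s) (coefficient≈0 1F)

    adjacent⇒distinctLines : ∀ {x₁ y₁ x₂ y₂ : U F n} → IsVertex F (x₁ , y₁) → IsVertex F (x₂ , y₂)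
      → Adjacent F v (x₁ , y₁) (x₂ , y₂) → DistinctLines (x₂ ∷ y₂ ∷ negU F y₁ ∷ [])
    adjacent⇒distinctLines p q adj =
      injective₃ _ (vertex⇒lines≢ q) (adjacent⇒lines≢ p q adj) (adjacent⇒lines≢ p (vertex-swap q) (adjacent-swap adj))

module ConvexPositiveBijections {c ℓ₁ ℓ₂} (F : OrderedField c ℓ₁ ℓ₂) {n₁ n₂}
  (v₁ : Fin n₁ → Vec3 F) (v₂ : Fin n₂ → Vec3 F) (normal₁ : IsNormalSystem F n₁ v₁) (normal₂ : IsNormalSystem F n₂ v₂)
  (δ : U F n₁ → U F n₂) (δ-injective : Injective _≡_ _≡_ δ) (δ-negU : ∀ u → δ (negU F u) ≡ negU F (δ u)) where

  module S₁ = SignedVectors F v₁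
  module S₂ = SignedVectors F v₂
  open S₁ using () renaming (vec to vec₁)
  open S₂ using () renaming (vec to vec₂)

  φ : Pair F n₁ → Pair F n₂
  φ = inducedMap F δ

  PositiveCombinationsPreserved : Set (c ⊔ ℓ₁ ⊔ ℓ₂)
  PositiveCombinationsPreserved = ∀ (b : Fin 3 → U F n₁) → IsBasis F (vec₁ ∘ b) → ∀ u →
    PosComb F (vec₁ u) (vec₁ ∘ b) ⇔ PosComb F (vec₂ (δ u)) (vec₂ ∘ δ ∘ b)

  lines-preserved : ∀ {x y} → proj₁ x ≡ proj₁ y → proj₁ (δ x) ≡ proj₁ (δ y)
  lines-preserved {x} {y} x∥y with S₁.sameLine x y x∥y
  ... | inj₁ x≡y  = ≡.cong (proj₁ ∘ δ) x≡y
  ... | inj₂ x≡-y = ≡.cong proj₁ (≡.trans (≡.cong δ x≡-y) (δ-negU y))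

  lines-reflected : ∀ {x y} → proj₁ (δ x) ≡ proj₁ (δ y) → proj₁ x ≡ proj₁ y
  lines-reflected {x} {y} δx∥δy with S₂.sameLine (δ x) (δ y) δx∥δy
  ... | inj₁ δx≡δy  = ≡.cong proj₁ (δ-injective δx≡δy)
  ... | inj₂ δx≡-δy = ≡.cong proj₁ (δ-injective (≡.trans δx≡-δy (≡.sym (δ-negU y))))

  distinctLines-preserved : ∀ {k} {b : Fin k → U F n₁} → S₁.DistinctLines b → S₂.DistinctLines (δ ∘ b)
  distinctLines-preserved distinct = distinct ∘ lines-reflected

  distinctLines-reflected : ∀ {k} {b : Fin k → U F n₁} → S₂.DistinctLines (δ ∘ b) → S₁.DistinctLines b
  distinctLines-reflected distinct = distinct ∘ lines-preserved

  vertex-preserved : ∀ {x y} → IsVertex F (x , y) → IsVertex F (δ x , δ y)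
  vertex-preserved {x} {y} (x≢y , x≢-y) = x≢y ∘ δ-injective , λ δx≡-δy → x≢-y (δ-injective (≡.trans δx≡-δy (≡.sym (δ-negU y))))

  vertex-reflected : ∀ {x y} → IsVertex F (δ x , δ y) → IsVertex F (x , y)
  vertex-reflected {x} {y} (δx≢δy , δx≢-δy) = δx≢δy ∘ ≡.cong δ , λ x≡-y → δx≢-δy (≡.trans (≡.cong δ x≡-y) (δ-negU y))

  samePair-preserved : ∀ {p q} → SamePair F p q → SamePair F (φ p) (φ q)
  samePair-preserved = Sum.map (Product.map (≡.cong δ) (≡.cong δ)) (Product.map (≡.cong δ) (≡.cong δ))

  samePair-reflected : ∀ {p q} → SamePair F (φ p) (φ q) → SamePair F p q
  samePair-reflected = Sum.map (Product.map δ-injective δ-injective) (Product.map δ-injective δ-injective)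

  vertices-surjective : Surjective _≡_ _≡_ δ → ∀ q → IsVertex F q → ∃ λ p → IsVertex F p × SamePair F (φ p) q
  vertices-surjective surjective (x′ , y′) q-vertex with surjective x′ | surjective y′
  ... | x , δx≡x′ | y , δy≡y′ with δx≡x′ ≡.refl | δy≡y′ ≡.refl
  ... | ≡.refl | ≡.refl = (x , y) , vertex-reflected q-vertex , inj₁ (≡.refl , ≡.refl)

  convexPositive⇒adjacency : PositiveCombinationsPreserved → ∀ {x₁ y₁ x₂ y₂} → IsVertex F (x₁ , y₁) → IsVertex F (x₂ , y₂)
    → Adjacent F v₁ (x₁ , y₁) (x₂ , y₂) ⇔ Adjacent F v₂ (δ x₁ , δ y₁) (δ x₂ , δ y₂)
  convexPositive⇒adjacency preserved {x₁} {y₁} {x₂} {y₂} p q = mk⇔ forward backward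
    where
    B : Fin 3 → U F n₁
    B = x₂ ∷ y₂ ∷ negU F y₁ ∷ []
    δB≡ : ∀ i → δ (B i) ≡ (δ x₂ ∷ δ y₂ ∷ negU F (δ y₁) ∷ []) i
    δB≡ 0F = ≡.refl
    δB≡ 1F = ≡.refl
    δB≡ 2F = δ-negU y₁
    forward : Adjacent F v₁ (x₁ , y₁) (x₂ , y₂) → Adjacent F v₂ (δ x₁ , δ y₁) (δ x₂ , δ y₂)
    forward adjacent = Equivalence.from (S₂.adjacent⇔posComb (¬same ∘ samePair-reflected))
      (S₂.posComb-resp≡ δB≡ (Equivalence.to (preserved B basis x₁) (Equivalence.to (S₁.adjacent⇔posComb ¬same) adjacent)))
      where
      ¬same = proj₁ adjacent
      basis = S₁.distinctLines⇒basis normal₁ B (S₁.adjacent⇒distinctLines normal₁ p q adjacent)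
    backward : Adjacent F v₂ (δ x₁ , δ y₁) (δ x₂ , δ y₂) → Adjacent F v₁ (x₁ , y₁) (x₂ , y₂)
    backward adjacent = Equivalence.from (S₁.adjacent⇔posComb (¬same ∘ samePair-preserved))
      (Equivalence.from (preserved B basis x₁) (S₂.posComb-resp≡ (≡.sym ∘ δB≡) (Equivalence.to (S₂.adjacent⇔posComb ¬same) adjacent)))
      where
      ¬same = proj₁ adjacent
      basis = S₁.distinctLines⇒basis normal₁ B (distinctLines-reflected (S₂.distinctLines-resp≡ (≡.sym ∘ δB≡)
                (S₂.adjacent⇒distinctLines normal₂ (vertex-preserved p) (vertex-preserved q) adjacent)))

  adjacency⇒convexPositive : (∀ p q → IsVertex F p → IsVertex F q → Adjacent F v₁ p q ⇔ Adjacent F v₂ (φ p) (φ q))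
    → PositiveCombinationsPreserved
  adjacency⇒convexPositive adjacency b (independent₁ , _) u = mk⇔ forward backward
    where
    distinct₁ = S₁.linIndep⇒distinctLines b independent₁
    independent₂ : LinIndep F 3 (vec₂ ∘ δ ∘ b)
    independent₂ = S₂.distinctLines⇒linIndep normal₂ ℕ.≤-refl (δ ∘ b) (distinctLines-preserved distinct₁)
    q-vertex : IsVertex F (b 0F , b 1F)
    q-vertex = S₁.lines≢⇒vertex λ e → case distinct₁ e of λ ()
    φp≡ : φ (u , negU F (b 2F)) ≡ (δ u , negU F (δ (b 2F)))
    φp≡ = ≡.cong (δ u ,_) (δ-negU (b 2F))
    forward : PosComb F (vec₁ u) (vec₁ ∘ b) → PosComb F (vec₂ (δ u)) (vec₂ ∘ δ ∘ b)
    forward pc = Equivalence.from (S₂.posComb⇔adjacent (δ ∘ b) (δ u) independent₂)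
      (≡.subst (λ p → Adjacent F v₂ p (δ (b 0F) , δ (b 1F))) φp≡
        (Equivalence.to (adjacency _ _ p-vertex q-vertex) (Equivalence.to (S₁.posComb⇔adjacent b u independent₁) pc)))
      where p-vertex = S₁.lines≢⇒vertex (S₁.posComb⇒lines≢ b u independent₁ pc)
    backward : PosComb F (vec₂ (δ u)) (vec₂ ∘ δ ∘ b) → PosComb F (vec₁ u) (vec₁ ∘ b)
    backward pc = Equivalence.from (S₁.posComb⇔adjacent b u independent₁)
      (Equivalence.from (adjacency _ _ p-vertex q-vertex)
        (≡.subst (λ p → Adjacent F v₂ p (δ (b 0F) , δ (b 1F))) (≡.sym φp≡)
          (Equivalence.to (S₂.posComb⇔adjacent (δ ∘ b) (δ u) independent₂) pc)))
      where p-vertex = S₁.lines≢⇒vertex (S₂.posComb⇒lines≢ (δ ∘ b) (δ u) independent₂ pc ∘ lines-preserved)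

mainTheorem5 : ∀ {c ℓ₁ ℓ₂ : Level} (F : OrderedField c ℓ₁ ℓ₂)
    (n₁ n₂ : ℕ) (v₁ : Fin n₁ → Vec3 F) (v₂ : Fin n₂ → Vec3 F)
    → IsNormalSystem F n₁ v₁ → IsNormalSystem F n₂ v₂
    → (δ : U F n₁ → U F n₂)
    → (IsConvexPositiveBijection F v₁ v₂ δ → IsGraphIso F v₁ v₂ (inducedMap F δ))
      × (Bijective _≡_ _≡_ δ → (∀ u → δ (negU F u) ≡ negU F (δ u))
          → IsGraphIso F v₁ v₂ (inducedMap F δ) → IsConvexPositiveBijection F v₁ v₂ δ)
mainTheorem5 F n₁ n₂ v₁ v₂ normal₁ normal₂ δ = isGraphIso , isConvexPositive
  where
  isGraphIso : IsConvexPositiveBijection F v₁ v₂ δ → IsGraphIso F v₁ v₂ (inducedMap F δ)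
  isGraphIso ((injective , surjective) , δ-negU , preserved) =
    (λ _ → vertex-preserved) , (λ _ _ _ _ → samePair-preserved) , (λ _ _ _ _ → samePair-reflected) ,
    vertices-surjective surjective , λ _ _ → convexPositive⇒adjacency preserved
    where open ConvexPositiveBijections F v₁ v₂ normal₁ normal₂ δ injective δ-negU
  isConvexPositive : Bijective _≡_ _≡_ δ → (∀ u → δ (negU F u) ≡ negU F (δ u))
    → IsGraphIso F v₁ v₂ (inducedMap F δ) → IsConvexPositiveBijection F v₁ v₂ δ
  isConvexPositive bijective δ-negU (_ , _ , _ , _ , adjacency) =
    bijective , δ-negU , adjacency⇒convexPositive adjacency
    where open ConvexPositiveBijections F v₁ v₂ normal₁ normal₂ δ (proj₁ bijective) δ-negU
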